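{- Let $Z$ be a multimatroid, let $\prec$ be a total ordering of its skew classes and let $T$ be a transversal of $Z$. Then \[ n(T) = |\mathrm{act}_\prec(\mathrm{ccl}_{\prec}(T))| - |T - \mathrm{ccl}_{\prec}(T)|,\] i.e. $n(T)$ equals the number of skew classes active with respect to $\mathrm{ccl}_\prec(T)$ minus the number of skew classes on which $T$ and $\mathrm{ccl}_\prec(T)$ differ.
   Context: A carrier is a pair $(U,\Omega)$, $U$ finite, $\Omega$ a partition of $U$ into non-empty skew classes; subtransversals meet each skew class at most once, transversals exactly once; skew pair: two distinct elements of a skew class. A multimatroid $Z=(U,\Omega,r)$ has a non-negative integer $r$ on subtransversals with (R1) on each transversal $r$ is a matroid rank function; (R2) for subtransversal $S$ and skew pair $\{x,y\}$ in a skew class disjoint from $S$, $r(S\cup\{x\})+r(S\cup\{y\})-2r(S)\ge1$. $n(S)=|S|-r(S)$; circuits are minimal subtransversals with $n>0$. $S_\omega$ is the element of $S\cap\omega$. The total order $\prec$ on skew classes induces an order on any subtransversal; $\min(C)$ is its least element. For a transversal $T$, skew class $\omega$ is active w.r.t. $T$ if there is a circuit $C$ with $\min(C)\in\omega$ and $C-\omega\subseteq T$; $\mathrm{act}_\prec(T)$ is the set of active classes. All such circuits have the same least element, denoted $\underline T_\omega$. $\mathrm{ccl}_\prec(T)$ is the transversal with $(\mathrm{ccl}_\prec(T))_\omega=\underline T_\omega$ for active $\omega$ and $T_\omega$ for inactive $\omega$. -}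

module Defs where

open import Data.Nat using (ℕ; _+_; _*_; _∸_; _≤_; _<_)
open import Data.Fin using (Fin)
open import Data.Fin.Subset using (Subset; _∈_; _⊆_; _∪_; _∩_; _─_; ⁅_⁆; ∣_∣)
open import Data.Product using (Σ; ∃; _×_; _,_)
open import Relation.Binary.PropositionalEquality using (_≡_)
open import Relation.Nullary using (¬_)
open import Function.Bundles using (_⇔_)

-- A carrier (U, Ω): U = Fin N, the skew classes are indexed by Fin m and
-- cls x is the skew class of the element x.  Skew classes are non-empty:
-- cls is surjective.  Subsets of U are 'Subset N'.

module _ {N m : ℕ} (cls : Fin N → Fin m) where

  IsSubtransversal : Subset N → Set
  IsSubtransversal S = ∀ {x y} → x ∈ S → y ∈ S → cls x ≡ cls y → x ≡ y

  IsTransversal : Subset N → Set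
  IsTransversal T = IsSubtransversal T × (∀ ω → ∃ λ x → x ∈ T × cls x ≡ ω)

-- The rank function r is given on all of Subset N, but only its values on
-- subtransversals are ever used (all axioms and notions below only evaluate
-- r on subtransversals).
record Multimatroid : Set₁ where
  field
    N m   : ℕ
    cls   : Fin N → Fin m
    nonempty : ∀ ω → ∃ λ x → cls x ≡ ω
    r     : Subset N → ℕ
    -- (R1) on each transversal T, X ↦ r X (X ⊆ T) is a matroid rank function
    R1-bound : ∀ T → IsTransversal cls T → ∀ X → X ⊆ T → r X ≤ ∣ X ∣
    R1-mono  : ∀ T → IsTransversal cls T → ∀ X Y → X ⊆ T → Y ⊆ T → X ⊆ Y → r X ≤ r Y
    R1-submod : ∀ T → IsTransversal cls T → ∀ X Y → X ⊆ T → Y ⊆ T →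
                r (X ∪ Y) + r (X ∩ Y) ≤ r X + r Y
    R2 : ∀ S → IsSubtransversal cls S → ∀ x y → ¬ x ≡ y → cls x ≡ cls y →
         (∀ {z} → z ∈ S → ¬ cls z ≡ cls x) →
         1 + 2 * r S ≤ r (S ∪ ⁅ x ⁆) + r (S ∪ ⁅ y ⁆)

module _ (Z : Multimatroid) where
  open Multimatroid Z

  nullity : Subset N → ℕ
  nullity S = ∣ S ∣ ∸ r S

  IsCircuit : Subset N → Set
  IsCircuit C = IsSubtransversal cls C × 0 < nullity C ×
                (∀ D → D ⊆ C → 0 < nullity D → D ≡ C)

  module _ (_≺_ : Fin m → Fin m → Set) where

    IsMinOf : Subset N → Fin N → Set
    IsMinOf C x = x ∈ C × (∀ {y} → y ∈ C → ¬ y ≡ x → cls x ≺ cls y)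

    IsActiveCircuit : Subset N → Fin m → Subset N → Fin N → Set
    IsActiveCircuit T ω C x =
      IsCircuit C × IsMinOf C x × cls x ≡ ω × (∀ {y} → y ∈ C → ¬ cls y ≡ ω → y ∈ T)

    Active : Subset N → Fin m → Set
    Active T ω = ∃ λ C → ∃ λ x → IsActiveCircuit T ω C x

    -- T' = ccl_≺(T): a transversal whose element in an active class ω is
    -- the (common) least element of the circuits witnessing activity, and
    -- which agrees with T on inactive classes.
    IsCcl : Subset N → Subset N → Set
    IsCcl T T' = IsTransversal cls T' ×
      (∀ ω → Active T ω → ∀ x → x ∈ T' → cls x ≡ ω → ∃ λ C → IsActiveCircuit T ω C x) ×
      (∀ ω → ¬ Active T ω → ∀ x → cls x ≡ ω → (x ∈ T' ⇔ x ∈ T))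

    IsActSet : Subset N → Subset m → Set
    IsActSet T A = ∀ ω → (ω ∈ A ⇔ Active T ω)

{-# OPTIONS --safe #-}

-- Write T' = ccl(T) and process the skew classes from the ≺-largest downwards. A class ω is active
-- for a transversal X, with least element y, exactly when y is spanned by X restricted to the
-- classes above ω, and by (R2) at most one element of ω is spanned in this way. So wherever T and T'
-- differ, T' holds the element spanned by the part of T above it; swapping it in lowers the rank by
-- exactly one, and this stays true after adding any subtransversal ρ living in lower classes. For
-- T' itself, adding T'_ω leaves the rank unchanged exactly when ω is active for T'. Induction over
-- the upsets of classes turns these two facts into r T = r T' + |T − T'| and |T| = r T' + |act(T')|.

module Submission where

open import Defs
open import Data.Nat using (ℕ; suc; _+_; _*_; _∸_; _≤_; _<_; _≤?_; z≤n; s≤s)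
open import Data.Nat.Properties
  using ( +-comm; +-suc; +-identityʳ; +-monoˡ-≤; +-monoʳ-≤; +-mono-≤; +-monoʳ-<
        ; +-cancelˡ-≤; +-cancelʳ-≤; +-cancelˡ-<; m≤m+n; ≤-antisym; ≤-trans; ≤-pred; ≰⇒>
        ; n<1+n; <-irrefl; n≤0⇒n≡0; m≤n⇒m∸n≡0; m<n⇒0<n∸m; [m+n]∸[m+o]≡n∸o; m∸n+n≡m
        ; module ≤-Reasoning )
open import Data.Fin using (Fin; zero; suc; _≟_)
open import Data.Fin.Properties using (any?)
open import Data.Fin.Subset
open import Data.Fin.Subset.Properties
open import Data.Fin.Subset.Induction using (⊂-wellFounded)
open import Data.Vec using ([]; _∷_; tabulate; here; there)
open import Data.Vec.Properties using (lookup∘tabulate; []=⇒lookup; lookup⇒[]=)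
open import Data.Product using (∃; _×_; _,_; proj₁; proj₂)
open import Data.Sum using (_⊎_; inj₁; inj₂)
open import Function using (_∘_; Equivalence)
open import Induction.WellFounded using (Acc; acc)
open import Level using (0ℓ)
open import Relation.Binary using (Rel; IsStrictTotalOrder; tri<; tri≈; tri>)
open import Relation.Binary.PropositionalEquality
open import Relation.Nullary using (¬_; Dec; yes; no; does; contradiction; _×-dec_)
open import Relation.Nullary.Decidable using (dec-true; decidable-stable)
open import Relation.Unary using (Pred; Decidable)

private
  variable
    n : ℕ

fromDec : ∀ {ℓ} {P : Pred (Fin n) ℓ} → Decidable P → Subset n
fromDec P? = tabulate (does ∘ P?)

module _ {ℓ} {P : Pred (Fin n) ℓ} (P? : Decidable P) where

  ∈-fromDec⁺ : ∀ {x} → P x → x ∈ fromDec P?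
  ∈-fromDec⁺ {x} px = lookup⇒[]= x _ (trans (lookup∘tabulate _ x) (dec-true (P? x) px))

  ∈-fromDec⁻ : ∀ {x} → x ∈ fromDec P? → P x
  ∈-fromDec⁻ {x} x∈ with P? x | trans (sym (lookup∘tabulate _ x)) ([]=⇒lookup x∈)
  ... | yes px | _ = px
  ... | no _   | ()

x∈p─q⇒x∉q : ∀ {x} {p q : Subset n} → x ∈ p ─ q → x ∉ q
x∈p─q⇒x∉q {p = _ ∷ _} {inside  ∷ _} ()        here
x∈p─q⇒x∉q {p = _ ∷ _} {_       ∷ _} (there x∈) (there x∈q) = x∈p─q⇒x∉q x∈ x∈q

∪-lub : ∀ {p q r : Subset n} → p ⊆ r → q ⊆ r → p ∪ q ⊆ r
∪-lub {p = p} {q} p⊆r q⊆r x∈ with x∈p∪q⁻ p q x∈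
... | inj₁ x∈p = p⊆r x∈p
... | inj₂ x∈q = q⊆r x∈q

∣p∪q∣≡∣p∣+∣q∣ : (p q : Subset n) → Empty (p ∩ q) → ∣ p ∪ q ∣ ≡ ∣ p ∣ + ∣ q ∣
∣p∪q∣≡∣p∣+∣q∣ []            []            _ = refl
∣p∪q∣≡∣p∣+∣q∣ (inside  ∷ p) (inside  ∷ q) e = contradiction (zero , here) e
∣p∪q∣≡∣p∣+∣q∣ (inside  ∷ p) (outside ∷ q) e = cong suc (∣p∪q∣≡∣p∣+∣q∣ p q (drop-∷-Empty e))
∣p∪q∣≡∣p∣+∣q∣ (outside ∷ p) (inside  ∷ q) e =
  trans (cong suc (∣p∪q∣≡∣p∣+∣q∣ p q (drop-∷-Empty e))) (sym (+-suc ∣ p ∣ ∣ q ∣))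
∣p∪q∣≡∣p∣+∣q∣ (outside ∷ p) (outside ∷ q) e = ∣p∪q∣≡∣p∣+∣q∣ p q (drop-∷-Empty e)

∣p∪⁅x⁆∣≡1+∣p∣ : ∀ {x} (p : Subset n) → x ∉ p → ∣ p ∪ ⁅ x ⁆ ∣ ≡ suc ∣ p ∣
∣p∪⁅x⁆∣≡1+∣p∣ {x = x} p x∉p = begin
  ∣ p ∪ ⁅ x ⁆ ∣      ≡⟨ ∣p∪q∣≡∣p∣+∣q∣ p ⁅ x ⁆ disjoint ⟩
  ∣ p ∣ + ∣ ⁅ x ⁆ ∣  ≡⟨ cong (∣ p ∣ +_) (∣⁅x⁆∣≡1 x) ⟩
  ∣ p ∣ + 1          ≡⟨ +-comm ∣ p ∣ 1 ⟩
  suc ∣ p ∣          ∎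
  where
  open ≡-Reasoning
  disjoint : Empty (p ∩ ⁅ x ⁆)
  disjoint (y , y∈) with x∈p∩q⁻ p ⁅ x ⁆ y∈
  ... | y∈p , y∈⁅x⁆ rewrite x∈⁅y⁆⇒x≡y x y∈⁅x⁆ = x∉p y∈p

p-x∪⁅x⁆≡p : ∀ {x} {p : Subset n} → x ∈ p → (p - x) ∪ ⁅ x ⁆ ≡ p
p-x∪⁅x⁆≡p {x = x} {p} x∈p =
  ⊆-antisym (∪-lub (p─q⊆p p ⁅ x ⁆) λ y∈⁅x⁆ → subst (_∈ p) (sym (x∈⁅y⁆⇒x≡y x y∈⁅x⁆)) x∈p) p⊆
  where
  p⊆ : p ⊆ (p - x) ∪ ⁅ x ⁆
  p⊆ {y} y∈p with y ≟ x
  ... | yes refl = q⊆p∪q (p - x) ⁅ x ⁆ (x∈⁅x⁆ x)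
  ... | no  y≢x  = p⊆p∪q ⁅ x ⁆ (x∈p∧x≢y⇒x∈p-y y∈p y≢x)

∣p∣≡1+∣p-x∣ : ∀ {x} {p : Subset n} → x ∈ p → ∣ p ∣ ≡ suc ∣ p - x ∣
∣p∣≡1+∣p-x∣ {x = x} {p} x∈p = trans (cong ∣_∣ (sym (p-x∪⁅x⁆≡p x∈p)))
  (∣p∪⁅x⁆∣≡1+∣p∣ (p - x) (λ x∈p-x → x∈p─q⇒x∉q x∈p-x (x∈⁅x⁆ x)))

p⊆q⇒p∪r⊆q∪r : ∀ {p q : Subset n} (r : Subset n) → p ⊆ q → p ∪ r ⊆ q ∪ r
p⊆q⇒p∪r⊆q∪r {q = q} r p⊆q = ∪-lub (p⊆p∪q r ∘ p⊆q) (q⊆p∪q q r)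

p∪[q─p]≡q : ∀ {p q : Subset n} → p ⊆ q → p ∪ (q ─ p) ≡ q
p∪[q─p]≡q {p = p} {q} p⊆q = ⊆-antisym (∪-lub p⊆q (p─q⊆p q p)) q⊆
  where
  q⊆ : q ⊆ p ∪ (q ─ p)
  q⊆ {x} x∈q with x ∈? p
  ... | yes x∈p = p⊆p∪q (q ─ p) x∈p
  ... | no  x∉p = q⊆p∪q p (q ─ p) (x∈p∧x∉q⇒x∈p─q x∈q x∉p)

∣p∣+∣q─p∣≡∣q∣ : ∀ {p q : Subset n} → p ⊆ q → ∣ p ∣ + ∣ q ─ p ∣ ≡ ∣ q ∣
∣p∣+∣q─p∣≡∣q∣ {p = p} {q} p⊆q =
  trans (sym (∣p∪q∣≡∣p∣+∣q∣ p (q ─ p) disjoint)) (cong ∣_∣ (p∪[q─p]≡q p⊆q))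
  where
  disjoint : Empty (p ∩ (q ─ p))
  disjoint (x , x∈) with x∈p∩q⁻ p (q ─ p) x∈
  ... | x∈p , x∈q─p = x∈p─q⇒x∉q x∈q─p x∈p

p-x∪p-y≡p : ∀ {x y} {p : Subset n} → x ≢ y → (p - x) ∪ (p - y) ≡ p
p-x∪p-y≡p {x = x} {y} {p} x≢y = ⊆-antisym (∪-lub (p─q⊆p p ⁅ x ⁆) (p─q⊆p p ⁅ y ⁆)) p⊆
  where
  p⊆ : p ⊆ (p - x) ∪ (p - y)
  p⊆ {z} z∈p with z ≟ x
  ... | yes refl = q⊆p∪q (p - z) (p - y) (x∈p∧x≢y⇒x∈p-y z∈p x≢y)
  ... | no  z≢x  = p⊆p∪q (p - y) (x∈p∧x≢y⇒x∈p-y z∈p z≢x)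

p-x-y⊆p-x∩p-y : ∀ {x y} (p : Subset n) → p - x - y ⊆ (p - x) ∩ (p - y)
p-x-y⊆p-x∩p-y {x = x} {y} p {z} z∈ = x∈p∩q⁺ (z∈p-x , x∈p∧x∉q⇒x∈p─q (p─q⊆p p ⁅ x ⁆ z∈p-x) (x∈p─q⇒x∉q z∈))
  where
  z∈p-x : z ∈ p - x
  z∈p-x = p─q⊆p (p - x) ⁅ y ⁆ z∈

[p∪⁅x⁆]-x≡p : ∀ {x} {p : Subset n} → x ∉ p → (p ∪ ⁅ x ⁆) - x ≡ p
[p∪⁅x⁆]-x≡p {x = x} {p} x∉p = ⊆-antisym ⊆p p⊆
  where
  ⊆p : (p ∪ ⁅ x ⁆) - x ⊆ p
  ⊆p z∈ with x∈p∪q⁻ p ⁅ x ⁆ (p─q⊆p _ ⁅ x ⁆ z∈)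
  ... | inj₁ z∈p   = z∈p
  ... | inj₂ z∈⁅x⁆ = contradiction z∈⁅x⁆ (x∈p─q⇒x∉q z∈)
  p⊆ : p ⊆ (p ∪ ⁅ x ⁆) - x
  p⊆ z∈p = x∈p∧x∉q⇒x∈p─q (p⊆p∪q ⁅ x ⁆ z∈p) λ z∈⁅x⁆ → x∉p (subst (_∈ p) (x∈⁅y⁆⇒x≡y x z∈⁅x⁆) z∈p)

[p∪⁅y⁆]-x≡p-x∪⁅y⁆ : ∀ {x y} {p : Subset n} → x ≢ y → (p ∪ ⁅ y ⁆) - x ≡ (p - x) ∪ ⁅ y ⁆
[p∪⁅y⁆]-x≡p-x∪⁅y⁆ {x = x} {y} {p} x≢y = ⊆-antisym ⊆r r⊆
  where
  ⊆r : (p ∪ ⁅ y ⁆) - x ⊆ (p - x) ∪ ⁅ y ⁆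
  ⊆r z∈ with x∈p∪q⁻ p ⁅ y ⁆ (p─q⊆p _ ⁅ x ⁆ z∈)
  ... | inj₁ z∈p   = p⊆p∪q ⁅ y ⁆ (x∈p∧x∉q⇒x∈p─q z∈p (x∈p─q⇒x∉q z∈))
  ... | inj₂ z∈⁅y⁆ = q⊆p∪q (p - x) ⁅ y ⁆ z∈⁅y⁆
  r⊆ : (p - x) ∪ ⁅ y ⁆ ⊆ (p ∪ ⁅ y ⁆) - x
  r⊆ {z} z∈ with x∈p∪q⁻ (p - x) ⁅ y ⁆ z∈
  ... | inj₁ z∈p-x = x∈p∧x∉q⇒x∈p─q (p⊆p∪q ⁅ y ⁆ (p─q⊆p p ⁅ x ⁆ z∈p-x)) (x∈p─q⇒x∉q z∈p-x)
  ... | inj₂ z∈⁅y⁆ rewrite x∈⁅y⁆⇒x≡y y z∈⁅y⁆ =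
    x∈p∧x≢y⇒x∈p-y (q⊆p∪q p ⁅ y ⁆ (x∈⁅x⁆ y)) (λ y≡x → x≢y (sym y≡x))

p∩[q∪⁅x⁆]≡p∩q∪⁅x⁆ : ∀ {x} {p : Subset n} (q : Subset n) → x ∈ p → p ∩ (q ∪ ⁅ x ⁆) ≡ p ∩ q ∪ ⁅ x ⁆
p∩[q∪⁅x⁆]≡p∩q∪⁅x⁆ {x = x} {p} q x∈p = trans (∩-distribˡ-∪ p q ⁅ x ⁆) (cong (p ∩ q ∪_) p∩⁅x⁆≡⁅x⁆)
  where
  p∩⁅x⁆≡⁅x⁆ : p ∩ ⁅ x ⁆ ≡ ⁅ x ⁆
  p∩⁅x⁆≡⁅x⁆ = ⊆-antisym (p∩q⊆q p ⁅ x ⁆)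
    λ y∈⁅x⁆ → x∈p∩q⁺ (subst (_∈ p) (sym (x∈⁅y⁆⇒x≡y x y∈⁅x⁆)) x∈p , y∈⁅x⁆)

p∩[q∪⁅x⁆]≡p∩q : ∀ {x} {p : Subset n} (q : Subset n) → x ∉ p → p ∩ (q ∪ ⁅ x ⁆) ≡ p ∩ q
p∩[q∪⁅x⁆]≡p∩q {x = x} {p} q x∉p = begin
  p ∩ (q ∪ ⁅ x ⁆)    ≡⟨ ∩-distribˡ-∪ p q ⁅ x ⁆ ⟩
  p ∩ q ∪ p ∩ ⁅ x ⁆  ≡⟨ cong (p ∩ q ∪_) p∩⁅x⁆≡⊥ ⟩
  p ∩ q ∪ ⊥          ≡⟨ ∪-identityʳ (p ∩ q) ⟩
  p ∩ q              ∎
  where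
  open ≡-Reasoning
  p∩⁅x⁆≡⊥ : p ∩ ⁅ x ⁆ ≡ ⊥
  p∩⁅x⁆≡⊥ = Empty-unique λ (y , y∈) → let (y∈p , y∈⁅x⁆) = x∈p∩q⁻ p ⁅ x ⁆ y∈
                                       in x∉p (subst (_∈ p) (x∈⁅y⁆⇒x≡y x y∈⁅x⁆) y∈p)

locally-minimal : ∀ {ℓ} {P : Pred (Subset n) ℓ} → Decidable P → ∀ {S} → P S →
                  ∃ λ D → D ⊆ S × P D × (∀ {z} → z ∈ D → ¬ P (D - z))
locally-minimal {P = P} P? {S} = go S (⊂-wellFounded S)
  where
  go : ∀ S → Acc _⊂_ S → P S → ∃ λ D → D ⊆ S × P D × (∀ {z} → z ∈ D → ¬ P (D - z))
  go S (acc rec) PS with any? (λ z → z ∈? S ×-dec P? (S - z))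
  ... | no  minimal = S , ⊆-refl , PS , λ z∈S PS-z → minimal (_ , z∈S , PS-z)
  ... | yes (z , z∈S , PS-z) with go (S - z) (rec (x∈p⇒p-x⊂p z∈S)) PS-z
  ...   | D , D⊆S-z , PD , D-minimal = D , p─q⊆p S ⁅ z ⁆ ∘ D⊆S-z , PD , D-minimal

[m+n]∸[m+o]+o≡n : ∀ k {a d} → k + d ≤ k + a → (k + a) ∸ (k + d) + d ≡ a
[m+n]∸[m+o]+o≡n k {a} {d} k+d≤k+a =
  trans (cong (_+ d) ([m+n]∸[m+o]≡n∸o k a d)) (m∸n+n≡m (+-cancelˡ-≤ k d a k+d≤k+a))

module Upsets {m ℓ} {_≺_ : Rel (Fin m) ℓ} (≺-isStrictTotalOrder : IsStrictTotalOrder _≡_ _≺_) where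
  open IsStrictTotalOrder ≺-isStrictTotalOrder
    using (compare; irrefl) renaming (trans to ≺-trans; _<?_ to _≺?_)

  above : Fin m → Subset m
  above ω = fromDec (ω ≺?_)

  Upset : Subset m → Set ℓ
  Upset Q = ∀ {a b} → a ∈ Q → a ≺ b → b ∈ Q

  IsLeast : Subset m → Fin m → Set ℓ
  IsLeast Q ω = ω ∈ Q × (∀ {c} → c ∈ Q → ω ≡ c ⊎ ω ≺ c)

  least : ∀ Q → Nonempty Q → ∃ (IsLeast Q)
  least Q = go Q (⊂-wellFounded Q)
    where
    go : ∀ Q → Acc _⊂_ Q → Nonempty Q → ∃ (IsLeast Q)
    go Q (acc rec) (x , x∈Q) with nonempty? (Q - x)
    ... | no Q-x-empty = x , x∈Q , x-least
      where
      x-least : ∀ {c} → c ∈ Q → x ≡ c ⊎ x ≺ c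
      x-least {c} c∈Q with c ≟ x
      ... | yes refl = inj₁ refl
      ... | no  c≢x  = contradiction (c , x∈p∧x≢y⇒x∈p-y c∈Q c≢x) Q-x-empty
    ... | yes Q-x-nonempty with go (Q - x) (rec (x∈p⇒p-x⊂p x∈Q)) Q-x-nonempty
    ...   | ω , ω∈Q-x , ω-least with compare x ω
    ...     | tri< x≺ω _ _ = x , x∈Q , x-least
      where
      x-least : ∀ {c} → c ∈ Q → x ≡ c ⊎ x ≺ c
      x-least {c} c∈Q with c ≟ x
      ... | yes refl = inj₁ refl
      ... | no  c≢x  with ω-least (x∈p∧x≢y⇒x∈p-y c∈Q c≢x)
      ...   | inj₁ refl = inj₂ x≺ω
      ...   | inj₂ ω≺c  = inj₂ (≺-trans x≺ω ω≺c)
    ...     | tri≈ _ refl _ = contradiction (x∈⁅x⁆ ω) (x∈p─q⇒x∉q ω∈Q-x)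
    ...     | tri> _ _ ω≺x = ω , p─q⊆p Q ⁅ x ⁆ ω∈Q-x , ω-least′
      where
      ω-least′ : ∀ {c} → c ∈ Q → ω ≡ c ⊎ ω ≺ c
      ω-least′ {c} c∈Q with c ≟ x
      ... | yes refl = inj₂ ω≺x
      ... | no  c≢x  = ω-least (x∈p∧x≢y⇒x∈p-y c∈Q c≢x)

  ∈-above⁺ : ∀ {ω c} → ω ≺ c → c ∈ above ω
  ∈-above⁺ {ω} = ∈-fromDec⁺ (ω ≺?_)

  ∈-above⁻ : ∀ {ω c} → c ∈ above ω → ω ≺ c
  ∈-above⁻ {ω} = ∈-fromDec⁻ (ω ≺?_)

  x∉above-x : ∀ ω → ω ∉ above ω
  x∉above-x ω ω∈ = irrefl refl (∈-above⁻ ω∈)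

  upset≡above-ω∪⁅ω⁆ : ∀ {Q ω} → Upset Q → IsLeast Q ω → Q ≡ above ω ∪ ⁅ ω ⁆
  upset≡above-ω∪⁅ω⁆ {Q} {ω} up (ω∈Q , ω-least) = ⊆-antisym Q⊆ ⊆Q
    where
    Q⊆ : Q ⊆ above ω ∪ ⁅ ω ⁆
    Q⊆ c∈Q with ω-least c∈Q
    ... | inj₁ refl = q⊆p∪q (above ω) ⁅ ω ⁆ (x∈⁅x⁆ ω)
    ... | inj₂ ω≺c  = p⊆p∪q ⁅ ω ⁆ (∈-above⁺ ω≺c)
    ⊆Q : above ω ∪ ⁅ ω ⁆ ⊆ Q
    ⊆Q c∈ with x∈p∪q⁻ (above ω) ⁅ ω ⁆ c∈
    ... | inj₁ c∈above = up ω∈Q (∈-above⁻ c∈above)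
    ... | inj₂ c∈⁅ω⁆ rewrite x∈⁅y⁆⇒x≡y ω c∈⁅ω⁆ = ω∈Q

  upset-induction : ∀ {p} (P : Subset m → Set p) →
                    P ⊥ → (∀ ω → P (above ω) → P (above ω ∪ ⁅ ω ⁆)) → P ⊤
  upset-induction P P⊥ step = go ⊤ (⊂-wellFounded ⊤) (λ _ _ → ∈⊤)
    where
    go : ∀ Q → Acc _⊂_ Q → Upset Q → P Q
    go Q (acc rec) up with nonempty? Q
    ... | no  Q-empty = subst P (sym (Empty-unique Q-empty)) P⊥
    ... | yes Q-nonempty with least Q Q-nonempty
    ...   | ω , ω-least@(ω∈Q , _) =
      subst P (sym Q≡) (step ω (go (above ω) (rec above⊂Q) above-upset))
      where
      Q≡ : Q ≡ above ω ∪ ⁅ ω ⁆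
      Q≡ = upset≡above-ω∪⁅ω⁆ up ω-least
      above⊂Q : above ω ⊂ Q
      above⊂Q = (λ c∈ → subst (_ ∈_) (sym Q≡) (p⊆p∪q ⁅ ω ⁆ c∈)) , ω , ω∈Q , x∉above-x ω
      above-upset : Upset (above ω)
      above-upset a∈ a≺b = ∈-above⁺ (≺-trans (∈-above⁻ a∈) a≺b)

module Properties (Z : Multimatroid) where
  open Multimatroid Z

  Subtransversal : Subset N → Set
  Subtransversal = IsSubtransversal cls

  ⊆-subtransversal : ∀ {X Y} → Subtransversal Y → X ⊆ Y → Subtransversal X
  ⊆-subtransversal stY X⊆Y x∈X y∈X = stY (X⊆Y x∈X) (X⊆Y y∈X)

  ⊥-subtransversal : Subtransversal ⊥
  ⊥-subtransversal x∈⊥ = contradiction x∈⊥ ∉⊥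

  ⁅⁆-subtransversal : ∀ x → Subtransversal ⁅ x ⁆
  ⁅⁆-subtransversal x a∈ b∈ _ = trans (x∈⁅y⁆⇒x≡y x a∈) (sym (x∈⁅y⁆⇒x≡y x b∈))

  ∪-subtransversal : ∀ {X Y} → Subtransversal X → Subtransversal Y →
                     (∀ {x y} → x ∈ X → y ∈ Y → cls x ≢ cls y) → Subtransversal (X ∪ Y)
  ∪-subtransversal {X} {Y} stX stY apart a∈ b∈ e with x∈p∪q⁻ X Y a∈ | x∈p∪q⁻ X Y b∈
  ... | inj₁ a∈X | inj₁ b∈X = stX a∈X b∈X e
  ... | inj₁ a∈X | inj₂ b∈Y = contradiction e (apart a∈X b∈Y)
  ... | inj₂ a∈Y | inj₁ b∈X = contradiction (sym e) (apart b∈X a∈Y)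
  ... | inj₂ a∈Y | inj₂ b∈Y = stY a∈Y b∈Y e

  extend-to-transversal : ∀ {S} → Subtransversal S → ∃ λ T → IsTransversal cls T × S ⊆ T
  extend-to-transversal {S} stS = T , (T-sub , T-total) , S⊆T
    where
    choose : ∀ ω → ∃ λ x → cls x ≡ ω × (∀ {y} → y ∈ S → cls y ≡ ω → y ≡ x)
    choose ω with any? (λ x → x ∈? S ×-dec cls x ≟ ω)
    ... | yes (x , x∈S , cls-x) = x , cls-x , λ y∈S cls-y → stS y∈S x∈S (trans cls-y (sym cls-x))
    ... | no  S-misses-ω        = proj₁ (nonempty ω) , proj₂ (nonempty ω) ,
                                  λ y∈S cls-y → contradiction (_ , y∈S , cls-y) S-misses-ω
    pick : Fin m → Fin N
    pick ω = proj₁ (choose ω)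
    picked? : ∀ x → Dec (x ≡ pick (cls x))
    picked? x = x ≟ pick (cls x)
    T : Subset N
    T = fromDec picked?
    T-sub : Subtransversal T
    T-sub x∈T y∈T e =
      trans (∈-fromDec⁻ picked? x∈T) (trans (cong pick e) (sym (∈-fromDec⁻ picked? y∈T)))
    T-total : ∀ ω → ∃ λ x → x ∈ T × cls x ≡ ω
    T-total ω = let (x , cls-x , _) = choose ω in
                x , ∈-fromDec⁺ picked? (cong pick (sym cls-x)) , cls-x
    S⊆T : S ⊆ T
    S⊆T {x} x∈S = ∈-fromDec⁺ picked? (proj₂ (proj₂ (choose (cls x))) x∈S refl)

  -- (R1) only constrains r inside a transversal, and every subtransversal lies in one.
  r-bound : ∀ {X} → Subtransversal X → r X ≤ ∣ X ∣
  r-bound stX with extend-to-transversal stX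
  ... | T , tT , X⊆T = R1-bound T tT _ X⊆T

  r-mono : ∀ {X Y} → Subtransversal Y → X ⊆ Y → r X ≤ r Y
  r-mono stY X⊆Y with extend-to-transversal stY
  ... | T , tT , Y⊆T = R1-mono T tT _ _ (Y⊆T ∘ X⊆Y) Y⊆T X⊆Y

  r-submod : ∀ {X Y} → Subtransversal (X ∪ Y) → r (X ∪ Y) + r (X ∩ Y) ≤ r X + r Y
  r-submod {X} {Y} st with extend-to-transversal st
  ... | T , tT , X∪Y⊆T = R1-submod T tT X Y (X∪Y⊆T ∘ p⊆p∪q Y) (X∪Y⊆T ∘ q⊆p∪q X Y)

  Spans : Subset N → Fin N → Set
  Spans S y = r (S ∪ ⁅ y ⁆) ≤ r S

  spans? : ∀ S y → Dec (Spans S y)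
  spans? S y = r (S ∪ ⁅ y ⁆) ≤? r S

  r-∪⁅⁆≤1+r : ∀ {S y} → Subtransversal (S ∪ ⁅ y ⁆) → r (S ∪ ⁅ y ⁆) ≤ suc (r S)
  r-∪⁅⁆≤1+r {S} {y} st = begin
    r (S ∪ ⁅ y ⁆)                  ≤⟨ m≤m+n _ _ ⟩
    r (S ∪ ⁅ y ⁆) + r (S ∩ ⁅ y ⁆)  ≤⟨ r-submod st ⟩
    r S + r ⁅ y ⁆                  ≤⟨ +-monoʳ-≤ (r S) r⁅y⁆≤1 ⟩
    r S + 1                        ≡⟨ +-comm (r S) 1 ⟩
    suc (r S)                      ∎
    where
    open ≤-Reasoning
    r⁅y⁆≤1 : r ⁅ y ⁆ ≤ 1
    r⁅y⁆≤1 = subst (r ⁅ y ⁆ ≤_) (∣⁅x⁆∣≡1 y) (r-bound (⁅⁆-subtransversal y))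

  spans⇒r-∪⁅⁆≡r : ∀ {S y} → Subtransversal (S ∪ ⁅ y ⁆) → Spans S y → r (S ∪ ⁅ y ⁆) ≡ r S
  spans⇒r-∪⁅⁆≡r st spans = ≤-antisym spans (r-mono st (p⊆p∪q _))

  ¬spans⇒r-∪⁅⁆≡1+r : ∀ {S y} → Subtransversal (S ∪ ⁅ y ⁆) → ¬ Spans S y → r (S ∪ ⁅ y ⁆) ≡ suc (r S)
  ¬spans⇒r-∪⁅⁆≡1+r st ¬spans = ≤-antisym (r-∪⁅⁆≤1+r st) (≰⇒> ¬spans)

  spans-mono : ∀ {S S' y} → Subtransversal (S' ∪ ⁅ y ⁆) → S ⊆ S' → Spans S y → Spans S' y
  spans-mono {S} {S'} {y} st S⊆S' spans = +-cancelʳ-≤ (r S) _ _ (begin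
    r (S' ∪ ⁅ y ⁆) + r S                       ≤⟨ +-monoʳ-≤ _ (r-mono st∩ S⊆∩) ⟩
    r (S' ∪ ⁅ y ⁆) + r ((S ∪ ⁅ y ⁆) ∩ S')      ≡⟨ cong (λ X → r X + r ((S ∪ ⁅ y ⁆) ∩ S')) (sym ∪≡) ⟩
    r ((S ∪ ⁅ y ⁆) ∪ S') + r ((S ∪ ⁅ y ⁆) ∩ S') ≤⟨ r-submod (subst Subtransversal (sym ∪≡) st) ⟩
    r (S ∪ ⁅ y ⁆) + r S'                       ≤⟨ +-monoˡ-≤ (r S') spans ⟩
    r S + r S'                                 ≡⟨ +-comm (r S) (r S') ⟩
    r S' + r S                                 ∎)
    where
    open ≤-Reasoning
    ∪≡ : (S ∪ ⁅ y ⁆) ∪ S' ≡ S' ∪ ⁅ y ⁆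
    ∪≡ = ⊆-antisym (∪-lub (p⊆q⇒p∪r⊆q∪r ⁅ y ⁆ S⊆S') (p⊆p∪q ⁅ y ⁆))
                   (∪-lub (q⊆p∪q _ S') (p⊆p∪q S' ∘ q⊆p∪q S ⁅ y ⁆))
    S⊆∩ : S ⊆ (S ∪ ⁅ y ⁆) ∩ S'
    S⊆∩ x∈S = x∈p∩q⁺ (p⊆p∪q ⁅ y ⁆ x∈S , S⊆S' x∈S)
    st∩ : Subtransversal ((S ∪ ⁅ y ⁆) ∩ S')
    st∩ = ⊆-subtransversal st (λ x∈ → p⊆p∪q ⁅ y ⁆ (p∩q⊆q _ S' x∈))

  spans-unique : ∀ {S y y'} → Subtransversal S → (∀ {z} → z ∈ S → cls z ≢ cls y) → cls y ≡ cls y' →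
                 Spans S y → Spans S y' → y ≡ y'
  spans-unique {S} {y} {y'} stS apart same-class spans spans' with y ≟ y'
  ... | yes y≡y' = y≡y'
  ... | no  y≢y' = contradiction (begin-strict
    r S + r S                        <⟨ n<1+n _ ⟩
    suc (r S + r S)                  ≡⟨ cong (λ k → suc (r S + k)) (+-identityʳ (r S)) ⟨
    1 + 2 * r S                      ≤⟨ R2 S stS y y' y≢y' same-class apart ⟩
    r (S ∪ ⁅ y ⁆) + r (S ∪ ⁅ y' ⁆)  ≤⟨ +-mono-≤ spans spans' ⟩
    r S + r S                        ∎) (<-irrefl refl)
    where open ≤-Reasoning

  Independent : Subset N → Set
  Independent X = ∣ X ∣ ≤ r X

  independent? : ∀ X → Dec (Independent X)
  independent? X = ∣ X ∣ ≤? r X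

  0<nullity⇒¬independent : ∀ {X} → 0 < nullity Z X → ¬ Independent X
  0<nullity⇒¬independent 0<n ind = <-irrefl (sym (m≤n⇒m∸n≡0 ind)) 0<n

  ¬independent⇒0<nullity : ∀ {X} → ¬ Independent X → 0 < nullity Z X
  ¬independent⇒0<nullity ¬ind = m<n⇒0<n∸m (≰⇒> ¬ind)

  independent-⊆ : ∀ {X Y} → Subtransversal Y → Independent Y → X ⊆ Y → Independent X
  independent-⊆ {X} {Y} stY indY X⊆Y = +-cancelʳ-≤ ∣ Y ─ X ∣ ∣ X ∣ (r X) (begin
    ∣ X ∣ + ∣ Y ─ X ∣                  ≡⟨ ∣p∣+∣q─p∣≡∣q∣ X⊆Y ⟩
    ∣ Y ∣                              ≤⟨ indY ⟩
    r Y                                ≡⟨ cong r (p∪[q─p]≡q X⊆Y) ⟨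
    r (X ∪ (Y ─ X))                    ≤⟨ m≤m+n _ _ ⟩
    r (X ∪ (Y ─ X)) + r (X ∩ (Y ─ X))  ≤⟨ r-submod (subst Subtransversal (sym (p∪[q─p]≡q X⊆Y)) stY) ⟩
    r X + r (Y ─ X)                    ≤⟨ +-monoʳ-≤ (r X) (r-bound stY─X) ⟩
    r X + ∣ Y ─ X ∣                    ∎)
    where
    open ≤-Reasoning
    stY─X : Subtransversal (Y ─ X)
    stY─X = ⊆-subtransversal stY (p─q⊆p Y X)

  IsColoop : Subset N → Fin N → Set
  IsColoop D e = r (D - e) < r D

  coloops⇒independent : ∀ {D} → Subtransversal D → (∀ {e} → e ∈ D → IsColoop D e) → Independent D
  coloops⇒independent {D} = go D (⊂-wellFounded D)
    where
    go : ∀ D → Acc _⊂_ D → Subtransversal D → (∀ {e} → e ∈ D → IsColoop D e) → Independent D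
    go D (acc rec) stD coloop with nonempty? D
    ... | no  D-empty = subst (_≤ r D) (sym (trans (cong ∣_∣ (Empty-unique D-empty)) (∣⊥∣≡0 N))) z≤n
    ... | yes (e , e∈D) = begin
      ∣ D ∣            ≡⟨ ∣p∣≡1+∣p-x∣ e∈D ⟩
      suc ∣ D - e ∣    ≤⟨ s≤s (go (D - e) (rec (x∈p⇒p-x⊂p e∈D)) stD-e coloop-e) ⟩
      suc (r (D - e))  ≤⟨ coloop e∈D ⟩
      r D              ∎
      where
      open ≤-Reasoning
      stD-e : Subtransversal (D - e)
      stD-e = ⊆-subtransversal stD (p─q⊆p D ⁅ e ⁆)
      coloop-e : ∀ {f} → f ∈ D - e → IsColoop (D - e) f
      coloop-e {f} f∈D-e = +-cancelˡ-< (r D) _ _ (begin-strict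
        r D + r (D - e - f)                            ≤⟨ +-monoʳ-≤ (r D) (r-mono st∩ (p-x-y⊆p-x∩p-y D)) ⟩
        r D + r ((D - e) ∩ (D - f))                    ≡⟨ cong (λ X → r X + r ((D - e) ∩ (D - f))) D≡ ⟨
        r ((D - e) ∪ (D - f)) + r ((D - e) ∩ (D - f))  ≤⟨ r-submod (subst Subtransversal (sym D≡) stD) ⟩
        r (D - e) + r (D - f)                          <⟨ +-monoʳ-< (r (D - e)) (coloop f∈D) ⟩
        r (D - e) + r D                                ≡⟨ +-comm (r (D - e)) (r D) ⟩
        r D + r (D - e)                                ∎)
        where
        f∈D : f ∈ D
        f∈D = p─q⊆p D ⁅ e ⁆ f∈D-e
        st∩ : Subtransversal ((D - e) ∩ (D - f))
        st∩ = ⊆-subtransversal stD-e (p∩q⊆p (D - e) (D - f))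
        D≡ : (D - e) ∪ (D - f) ≡ D
        D≡ = p-x∪p-y≡p (λ e≡f → x∈p─q⇒x∉q f∈D-e (subst (_∈ ⁅ e ⁆) e≡f (x∈⁅x⁆ e)))

  ¬independent-∪⁅⁆⇒spans : ∀ {X y} → y ∉ X → Independent X → ¬ Independent (X ∪ ⁅ y ⁆) → Spans X y
  ¬independent-∪⁅⁆⇒spans {X} {y} y∉X indX dep = ≤-trans (≤-pred (begin-strict
    r (X ∪ ⁅ y ⁆)   <⟨ ≰⇒> dep ⟩
    ∣ X ∪ ⁅ y ⁆ ∣   ≡⟨ ∣p∪⁅x⁆∣≡1+∣p∣ X y∉X ⟩
    suc ∣ X ∣       ∎)) indX
    where open ≤-Reasoning

  minimally-dependent⇒circuit : ∀ {C} → Subtransversal C → ¬ Independent C →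
                                (∀ {z} → z ∈ C → Independent (C - z)) → IsCircuit Z C
  minimally-dependent⇒circuit {C} stC dep indep = stC , ¬independent⇒0<nullity dep , minimal
    where
    minimal : ∀ D → D ⊆ C → 0 < nullity Z D → D ≡ C
    minimal D D⊆C 0<nD = ⊆-antisym D⊆C C⊆D
      where
      C⊆D : C ⊆ D
      C⊆D {z} z∈C = decidable-stable (z ∈? D) λ z∉D →
        0<nullity⇒¬independent 0<nD
          (independent-⊆ (⊆-subtransversal stC (p─q⊆p C ⁅ z ⁆)) (indep z∈C) (D⊆C-z z∉D))
        where
        D⊆C-z : z ∉ D → D ⊆ C - z
        D⊆C-z z∉D x∈D = x∈p∧x≢y⇒x∈p-y (D⊆C x∈D) (λ { refl → z∉D x∈D })

  circuit⇒spans : ∀ {C y} → IsCircuit Z C → y ∈ C → Spans (C - y) y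
  circuit⇒spans {C} {y} (stC , 0<nC , minimal) y∈C =
    ¬independent-∪⁅⁆⇒spans y∉C-y C-y-independent
      (subst (λ X → ¬ Independent X) (sym (p-x∪⁅x⁆≡p y∈C)) (0<nullity⇒¬independent 0<nC))
    where
    y∉C-y : y ∉ C - y
    y∉C-y y∈C-y = x∈p─q⇒x∉q y∈C-y (x∈⁅x⁆ y)
    C-y-independent : Independent (C - y)
    C-y-independent = decidable-stable (independent? (C - y)) λ dep →
      y∉C-y (subst (y ∈_) (sym (minimal (C - y) (p─q⊆p C ⁅ y ⁆) (¬independent⇒0<nullity dep))) y∈C)

  spans⇒circuit : ∀ {S y} → Subtransversal (S ∪ ⁅ y ⁆) → y ∉ S → Spans S y →
                    ∃ λ C → IsCircuit Z C × y ∈ C × C ⊆ S ∪ ⁅ y ⁆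
  spans⇒circuit {S} {y} st y∉S S-spans with locally-minimal (λ D → spans? D y) S-spans
  ... | D , D⊆S , D-spans , D-minimal =
    D ∪ ⁅ y ⁆ , minimally-dependent⇒circuit stC C-dependent C-z-independent ,
    q⊆p∪q D ⁅ y ⁆ (x∈⁅x⁆ y) , C⊆
    where
    C⊆ : D ∪ ⁅ y ⁆ ⊆ S ∪ ⁅ y ⁆
    C⊆ = p⊆q⇒p∪r⊆q∪r ⁅ y ⁆ D⊆S
    stC : Subtransversal (D ∪ ⁅ y ⁆)
    stC = ⊆-subtransversal st C⊆
    stD : Subtransversal D
    stD = ⊆-subtransversal stC (p⊆p∪q ⁅ y ⁆)
    y∉D : y ∉ D
    y∉D = y∉S ∘ D⊆S
    D-independent : Independent D
    D-independent = coloops⇒independent stD coloop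
      where
      coloop : ∀ {e} → e ∈ D → IsColoop D e
      coloop {e} e∈D = ≰⇒> λ rD≤rD-e → D-minimal e∈D (begin
        r ((D - e) ∪ ⁅ y ⁆)  ≤⟨ r-mono stC (p⊆q⇒p∪r⊆q∪r ⁅ y ⁆ (p─q⊆p D ⁅ e ⁆)) ⟩
        r (D ∪ ⁅ y ⁆)        ≤⟨ D-spans ⟩
        r D                  ≤⟨ rD≤rD-e ⟩
        r (D - e)            ∎)
        where open ≤-Reasoning
    C-dependent : ¬ Independent (D ∪ ⁅ y ⁆)
    C-dependent ind = <-irrefl refl (begin-strict
      ∣ D ∣               <⟨ n<1+n ∣ D ∣ ⟩
      suc ∣ D ∣           ≡⟨ ∣p∪⁅x⁆∣≡1+∣p∣ D y∉D ⟨
      ∣ D ∪ ⁅ y ⁆ ∣       ≤⟨ ind ⟩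
      r (D ∪ ⁅ y ⁆)       ≤⟨ D-spans ⟩
      r D                 ≤⟨ r-bound stD ⟩
      ∣ D ∣               ∎)
      where open ≤-Reasoning
    C-z-independent : ∀ {z} → z ∈ D ∪ ⁅ y ⁆ → Independent ((D ∪ ⁅ y ⁆) - z)
    C-z-independent {z} z∈C with z ≟ y
    ... | yes refl = subst Independent (sym ([p∪⁅x⁆]-x≡p y∉D)) D-independent
    ... | no  z≢y  = subst Independent (sym ([p∪⁅y⁆]-x≡p-x∪⁅y⁆ z≢y)) D-z∪y-independent
      where
      z∈D : z ∈ D
      z∈D with x∈p∪q⁻ D ⁅ y ⁆ z∈C
      ... | inj₁ z∈D   = z∈D
      ... | inj₂ z∈⁅y⁆ = contradiction (x∈⁅y⁆⇒x≡y y z∈⁅y⁆) z≢y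
      D-z∪y-independent : Independent ((D - z) ∪ ⁅ y ⁆)
      D-z∪y-independent = decidable-stable (independent? ((D - z) ∪ ⁅ y ⁆)) λ dep →
        D-minimal z∈D (¬independent-∪⁅⁆⇒spans (y∉D ∘ p─q⊆p D ⁅ z ⁆) D-z-independent dep)
        where
        D-z-independent : Independent (D - z)
        D-z-independent = independent-⊆ stD D-independent (p─q⊆p D ⁅ z ⁆)

  ∈↾? : (X : Subset N) (Q : Subset m) → Decidable (λ x → x ∈ X × cls x ∈ Q)
  ∈↾? X Q x = x ∈? X ×-dec cls x ∈? Q

  _↾_ : Subset N → Subset m → Subset N
  X ↾ Q = fromDec (∈↾? X Q)

  ∈-↾⁺ : ∀ {X Q x} → x ∈ X → cls x ∈ Q → x ∈ X ↾ Q
  ∈-↾⁺ {X} {Q} x∈X cls-x∈Q = ∈-fromDec⁺ (∈↾? X Q) (x∈X , cls-x∈Q)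

  ∈-↾⁻ : ∀ {X Q x} → x ∈ X ↾ Q → x ∈ X × cls x ∈ Q
  ∈-↾⁻ {X} {Q} = ∈-fromDec⁻ (∈↾? X Q)

  ↾-⊆ : ∀ {X Q} → X ↾ Q ⊆ X
  ↾-⊆ = proj₁ ∘ ∈-↾⁻

  ↾-⊥ : ∀ X → X ↾ ⊥ ≡ ⊥
  ↾-⊥ X = Empty-unique (λ (x , x∈) → ∉⊥ (proj₂ (∈-↾⁻ x∈)))

  ↾-⊤ : ∀ X → X ↾ ⊤ ≡ X
  ↾-⊤ X = ⊆-antisym ↾-⊆ (λ x∈X → ∈-↾⁺ x∈X ∈⊤)

  ↾-∪⁅⁆ : ∀ {X Q x ω} → Subtransversal X → x ∈ X → cls x ≡ ω → X ↾ (Q ∪ ⁅ ω ⁆) ≡ X ↾ Q ∪ ⁅ x ⁆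
  ↾-∪⁅⁆ {X} {Q} {x} {ω} stX x∈X cls-x = ⊆-antisym ⊆r r⊆
    where
    ⊆r : X ↾ (Q ∪ ⁅ ω ⁆) ⊆ X ↾ Q ∪ ⁅ x ⁆
    ⊆r z∈ with ∈-↾⁻ z∈
    ... | z∈X , cls-z∈ with x∈p∪q⁻ Q ⁅ ω ⁆ cls-z∈
    ...   | inj₁ cls-z∈Q = p⊆p∪q ⁅ x ⁆ (∈-↾⁺ z∈X cls-z∈Q)
    ...   | inj₂ cls-z∈⁅ω⁆ rewrite stX z∈X x∈X (trans (x∈⁅y⁆⇒x≡y ω cls-z∈⁅ω⁆) (sym cls-x)) =
      q⊆p∪q (X ↾ Q) ⁅ x ⁆ (x∈⁅x⁆ x)
    r⊆ : X ↾ Q ∪ ⁅ x ⁆ ⊆ X ↾ (Q ∪ ⁅ ω ⁆)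
    r⊆ = ∪-lub (λ z∈ → let (z∈X , cls-z∈Q) = ∈-↾⁻ z∈ in ∈-↾⁺ z∈X (p⊆p∪q ⁅ ω ⁆ cls-z∈Q))
               (λ z∈⁅x⁆ → subst (_∈ X ↾ (Q ∪ ⁅ ω ⁆)) (sym (x∈⁅y⁆⇒x≡y x z∈⁅x⁆))
                                (∈-↾⁺ x∈X (q⊆p∪q Q ⁅ ω ⁆ (subst (_∈ ⁅ ω ⁆) (sym cls-x) (x∈⁅x⁆ ω)))))

  ↾-∪⁅⁆-missing : ∀ {X Q ω} → (∀ {x} → x ∈ X → cls x ≢ ω) → X ↾ (Q ∪ ⁅ ω ⁆) ≡ X ↾ Q
  ↾-∪⁅⁆-missing {X} {Q} {ω} misses = ⊆-antisym ⊆r r⊆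
    where
    ⊆r : X ↾ (Q ∪ ⁅ ω ⁆) ⊆ X ↾ Q
    ⊆r z∈ with ∈-↾⁻ z∈
    ... | z∈X , cls-z∈ with x∈p∪q⁻ Q ⁅ ω ⁆ cls-z∈
    ...   | inj₁ cls-z∈Q   = ∈-↾⁺ z∈X cls-z∈Q
    ...   | inj₂ cls-z∈⁅ω⁆ = contradiction (x∈⁅y⁆⇒x≡y ω cls-z∈⁅ω⁆) (misses z∈X)
    r⊆ : X ↾ Q ⊆ X ↾ (Q ∪ ⁅ ω ⁆)
    r⊆ z∈ = let (z∈X , cls-z∈Q) = ∈-↾⁻ z∈ in ∈-↾⁺ z∈X (p⊆p∪q ⁅ ω ⁆ cls-z∈Q)

  ∣↾∪⁅⁆∣≡1+∣↾∣ : ∀ {X Q x} → cls x ∉ Q → ∣ X ↾ Q ∪ ⁅ x ⁆ ∣ ≡ suc ∣ X ↾ Q ∣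
  ∣↾∪⁅⁆∣≡1+∣↾∣ {X} {Q} cls-x∉Q = ∣p∪⁅x⁆∣≡1+∣p∣ (X ↾ Q) (cls-x∉Q ∘ proj₂ ∘ ∈-↾⁻)

  Avoids : Subset N → Subset m → Set
  Avoids ρ Q = ∀ {x} → x ∈ ρ → cls x ∉ Q

  ↾-∪-subtransversal : ∀ {X Q ρ} → Subtransversal X → Subtransversal ρ → Avoids ρ Q →
                       Subtransversal (X ↾ Q ∪ ρ)
  ↾-∪-subtransversal stX stρ avoids = ∪-subtransversal (⊆-subtransversal stX ↾-⊆) stρ
    λ x∈ y∈ cls-x≡cls-y → avoids y∈ (subst (_∈ _) cls-x≡cls-y (proj₂ (∈-↾⁻ x∈)))

module ActiveCircuits (Z : Multimatroid) {_≺_ : Rel (Fin (Multimatroid.m Z)) 0ℓ}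
                      (≺-isStrictTotalOrder : IsStrictTotalOrder _≡_ _≺_) where
  open Multimatroid Z
  open IsStrictTotalOrder ≺-isStrictTotalOrder using (irrefl)
  open Upsets ≺-isStrictTotalOrder

  open Properties Z

  ↾above-∪⁅⁆-subtransversal : ∀ {X ω y} → Subtransversal X → cls y ≡ ω →
                              Subtransversal (X ↾ above ω ∪ ⁅ y ⁆)
  ↾above-∪⁅⁆-subtransversal {ω = ω} {y} stX cls-y = ↾-∪-subtransversal stX (⁅⁆-subtransversal y)
    λ z∈⁅y⁆ → subst (λ z → cls z ∉ above ω) (sym (x∈⁅y⁆⇒x≡y y z∈⁅y⁆))
                    (subst (_∉ above ω) (sym cls-y) (x∉above-x ω))

  activeCircuit⇒spans : ∀ {X ω C y} → Subtransversal X → IsActiveCircuit Z _≺_ X ω C y →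
                        Spans (X ↾ above ω) y
  activeCircuit⇒spans {X} {ω} {C} {y} stX (circuit , (y∈C , y-least) , cls-y , outside-ω⊆X) =
    spans-mono (↾above-∪⁅⁆-subtransversal stX cls-y) C-y⊆ (circuit⇒spans circuit y∈C)
    where
    C-y⊆ : C - y ⊆ X ↾ above ω
    C-y⊆ {z} z∈C-y =
      ∈-↾⁺ (outside-ω⊆X z∈C (λ cls-z → irrefl (sym cls-z) ω≺cls-z)) (∈-above⁺ ω≺cls-z)
      where
      z∈C : z ∈ C
      z∈C = p─q⊆p C ⁅ y ⁆ z∈C-y
      ω≺cls-z : ω ≺ cls z
      ω≺cls-z = subst (_≺ cls z) cls-y (y-least z∈C (λ { refl → x∈p─q⇒x∉q z∈C-y (x∈⁅x⁆ y) }))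

  circuit⇒activeCircuit : ∀ {X ω C y} → cls y ≡ ω → IsCircuit Z C → y ∈ C →
                          C ⊆ X ↾ above ω ∪ ⁅ y ⁆ → IsActiveCircuit Z _≺_ X ω C y
  circuit⇒activeCircuit {X} {ω} {C} {y} cls-y circuit y∈C C⊆ =
    circuit , (y∈C , y-least) , cls-y , outside-ω⊆X
    where
    in-part : ∀ {z} → z ∈ C → z ≢ y → z ∈ X × ω ≺ cls z
    in-part {z} z∈C z≢y with x∈p∪q⁻ (X ↾ above ω) ⁅ y ⁆ (C⊆ z∈C)
    ... | inj₁ z∈X↾  = proj₁ (∈-↾⁻ z∈X↾) , ∈-above⁻ (proj₂ (∈-↾⁻ z∈X↾))
    ... | inj₂ z∈⁅y⁆ = contradiction (x∈⁅y⁆⇒x≡y y z∈⁅y⁆) z≢y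
    y-least : ∀ {z} → z ∈ C → z ≢ y → cls y ≺ cls z
    y-least z∈C z≢y = subst (_≺ _) (sym cls-y) (proj₂ (in-part z∈C z≢y))
    outside-ω⊆X : ∀ {z} → z ∈ C → cls z ≢ ω → z ∈ X
    outside-ω⊆X z∈C cls-z≢ω = proj₁ (in-part z∈C (λ z≡y → cls-z≢ω (trans (cong cls z≡y) cls-y)))

  spans⇒activeCircuit : ∀ {X ω y} → Subtransversal X → cls y ≡ ω → Spans (X ↾ above ω) y →
                        ∃ λ C → IsActiveCircuit Z _≺_ X ω C y
  spans⇒activeCircuit {X} {ω} {y} stX cls-y spans =
    let (C , circuit , y∈C , C⊆) = spans⇒circuit (↾above-∪⁅⁆-subtransversal stX cls-y) y∉ spans
    in C , circuit⇒activeCircuit cls-y circuit y∈C C⊆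
    where
    y∉ : y ∉ X ↾ above ω
    y∉ y∈ = x∉above-x ω (subst (_∈ above ω) cls-y (proj₂ (∈-↾⁻ y∈)))

module NullityFormula (Z : Multimatroid) {_≺_ : Rel (Fin (Multimatroid.m Z)) 0ℓ}
         (≺-isStrictTotalOrder : IsStrictTotalOrder _≡_ _≺_)
         {T : Subset (Multimatroid.N Z)} (T-transversal : IsTransversal (Multimatroid.cls Z) T)
         {T' : Subset (Multimatroid.N Z)} (T'-ccl : IsCcl Z _≺_ T T')
         {A : Subset (Multimatroid.m Z)} (A-active : IsActSet Z _≺_ T' A) where
  open Multimatroid Z
  open Properties Z
  open Upsets ≺-isStrictTotalOrder
  open ActiveCircuits Z ≺-isStrictTotalOrder
  open Equivalence

  T'-transversal : IsTransversal cls T'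
  T'-transversal = proj₁ T'-ccl

  stT : Subtransversal T
  stT = proj₁ T-transversal

  stT' : Subtransversal T'
  stT' = proj₁ T'-transversal

  -- Quantifying over ρ makes rank-shift strong enough for the induction step, which moves the
  -- element of the next class into ρ.
  record Invariant (Q : Subset m) : Set where
    field
      rank-shift : ∀ {ρ} → Subtransversal ρ → Avoids ρ Q →
                   r (T' ↾ Q ∪ ρ) + ∣ (T ─ T') ↾ Q ∣ ≡ r (T ↾ Q ∪ ρ)
      rank-count : r (T' ↾ Q) + ∣ A ∩ Q ∣ ≡ ∣ T ↾ Q ∣

  rank-shift₀ : ∀ {Q} → Invariant Q → r (T' ↾ Q) + ∣ (T ─ T') ↾ Q ∣ ≡ r (T ↾ Q)
  rank-shift₀ {Q} inv =
    subst₂ (λ X Y → r X + ∣ (T ─ T') ↾ Q ∣ ≡ r Y) (∪-identityʳ (T' ↾ Q)) (∪-identityʳ (T ↾ Q))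
           (Invariant.rank-shift inv ⊥-subtransversal (λ x∈⊥ → contradiction x∈⊥ ∉⊥))

  invariant-⊥ : Invariant ⊥
  invariant-⊥ = record { rank-shift = rank-shift ; rank-count = rank-count }
    where
    rank-shift : ∀ {ρ} → Subtransversal ρ → Avoids ρ ⊥ →
                 r (T' ↾ ⊥ ∪ ρ) + ∣ (T ─ T') ↾ ⊥ ∣ ≡ r (T ↾ ⊥ ∪ ρ)
    rank-shift {ρ} _ _ rewrite ↾-⊥ T' | ↾-⊥ (T ─ T') | ↾-⊥ T | ∣⊥∣≡0 N = +-identityʳ (r (⊥ ∪ ρ))
    rank-count : r (T' ↾ ⊥) + ∣ A ∩ ⊥ ∣ ≡ ∣ T ↾ ⊥ ∣
    rank-count rewrite ↾-⊥ T' | ↾-⊥ T | ∩-zeroʳ A | ∣⊥∣≡0 N | ∣⊥∣≡0 m =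
      trans (+-identityʳ (r ⊥)) (n≤0⇒n≡0 (subst (r ⊥ ≤_) (∣⊥∣≡0 N) (r-bound ⊥-subtransversal)))

  module Step (ω : Fin m) (IH : Invariant (above ω)) where
    open Invariant IH

    Q₀ Q : Subset m
    Q₀ = above ω
    Q  = Q₀ ∪ ⁅ ω ⁆

    t x' : Fin N
    t  = proj₁ (proj₂ T-transversal ω)
    x' = proj₁ (proj₂ T'-transversal ω)

    t∈T : t ∈ T
    t∈T = proj₁ (proj₂ (proj₂ T-transversal ω))
    x'∈T' : x' ∈ T'
    x'∈T' = proj₁ (proj₂ (proj₂ T'-transversal ω))
    cls-t : cls t ≡ ω
    cls-t = proj₂ (proj₂ (proj₂ T-transversal ω))
    cls-x' : cls x' ≡ ω
    cls-x' = proj₂ (proj₂ (proj₂ T'-transversal ω))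

    S S' : Subset N
    S  = T ↾ Q₀
    S' = T' ↾ Q₀

    d₀ : ℕ
    d₀ = ∣ (T ─ T') ↾ Q₀ ∣

    cls≡ω⇒∉Q₀ : ∀ {y} → cls y ≡ ω → cls y ∉ Q₀
    cls≡ω⇒∉Q₀ cls-y = subst (_∉ Q₀) (sym cls-y) (x∉above-x ω)

    ↾Q₀-misses-ω : ∀ {X y z} → z ∈ X ↾ Q₀ → cls y ≡ ω → cls z ≢ cls y
    ↾Q₀-misses-ω z∈ cls-y cls-z≡cls-y = cls≡ω⇒∉Q₀ (trans cls-z≡cls-y cls-y) (proj₂ (∈-↾⁻ z∈))

    rank-shift-⁅⁆ : ∀ {y} → cls y ≡ ω → r (S' ∪ ⁅ y ⁆) + d₀ ≡ r (S ∪ ⁅ y ⁆)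
    rank-shift-⁅⁆ {y} cls-y = rank-shift (⁅⁆-subtransversal y)
      λ z∈⁅y⁆ → subst (λ z → cls z ∉ Q₀) (sym (x∈⁅y⁆⇒x≡y y z∈⁅y⁆)) (cls≡ω⇒∉Q₀ cls-y)

    spans-S'⇒spans-S : ∀ {y} → cls y ≡ ω → Spans S' y → Spans S y
    spans-S'⇒spans-S cls-y spans =
      subst₂ _≤_ (rank-shift-⁅⁆ cls-y) (rank-shift₀ IH) (+-monoˡ-≤ d₀ spans)

    spans-S⇒spans-S' : ∀ {y} → cls y ≡ ω → Spans S y → Spans S' y
    spans-S⇒spans-S' cls-y spans =
      +-cancelʳ-≤ _ _ _ (subst₂ _≤_ (sym (rank-shift-⁅⁆ cls-y)) (sym (rank-shift₀ IH)) spans)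

    active⇒spans-x' : Active Z _≺_ T ω → Spans S x'
    active⇒spans-x' active = activeCircuit⇒spans stT
      (proj₂ (proj₁ (proj₂ T'-ccl) ω active x' x'∈T' cls-x'))

    -- If ω were inactive for T, ccl would have kept t.
    t≢x'⇒spans-x' : t ≢ x' → Spans S x'
    t≢x'⇒spans-x' t≢x' = decidable-stable (spans? S x') λ ¬spans →
      t≢x' (stT t∈T (x'∈T ¬spans) (trans cls-t (sym cls-x')))
      where
      x'∈T : ¬ Spans S x' → x' ∈ T
      x'∈T ¬spans = to (proj₂ (proj₂ T'-ccl) ω (¬spans ∘ active⇒spans-x') x' cls-x') x'∈T'

    spans-x'⇒ω∈A : Spans S' x' → ω ∈ A
    spans-x'⇒ω∈A spans =
      let (C , circuit) = spans⇒activeCircuit stT' cls-x' spans in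
      from (A-active ω) (C , x' , circuit)

    -- The least element y of the circuit is spanned by S' and hence by S, so ω is active for T;
    -- then x' is spanned by S as well, and (R2) forces y = x'.
    activeCircuit-T'⇒spans-x' : ∀ {C y} → IsActiveCircuit Z _≺_ T' ω C y → Spans S' x'
    activeCircuit-T'⇒spans-x' {C} {y} circuit@(_ , _ , cls-y , _) = subst (Spans S') y≡x' spans-S'-y
      where
      spans-S'-y : Spans S' y
      spans-S'-y = activeCircuit⇒spans stT' circuit
      spans-S-y : Spans S y
      spans-S-y = spans-S'⇒spans-S cls-y spans-S'-y
      T-active : Active Z _≺_ T ω
      T-active = let (C' , circuit') = spans⇒activeCircuit stT cls-y spans-S-y in C' , y , circuit'
      y≡x' : y ≡ x'
      y≡x' = spans-unique (⊆-subtransversal stT ↾-⊆) (λ z∈ → ↾Q₀-misses-ω z∈ cls-y)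
                          (trans cls-y (sym cls-x')) spans-S-y (active⇒spans-x' T-active)

    ω∈A⇒spans-x' : ω ∈ A → Spans S' x'
    ω∈A⇒spans-x' ω∈A = activeCircuit-T'⇒spans-x' (proj₂ (proj₂ (to (A-active ω) ω∈A)))

    rank-count-step : r (T' ↾ Q) + ∣ A ∩ Q ∣ ≡ ∣ T ↾ Q ∣
    rank-count-step = begin
      r (T' ↾ Q) + ∣ A ∩ Q ∣           ≡⟨ cong (λ X → r X + ∣ A ∩ Q ∣) (↾-∪⁅⁆ stT' x'∈T' cls-x') ⟩
      r (S' ∪ ⁅ x' ⁆) + ∣ A ∩ Q ∣      ≡⟨ count-at-ω (ω ∈? A) ⟩
      suc (r S' + ∣ A ∩ Q₀ ∣)          ≡⟨ cong suc rank-count ⟩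
      suc ∣ S ∣                        ≡⟨ ∣↾∪⁅⁆∣≡1+∣↾∣ (cls≡ω⇒∉Q₀ cls-t) ⟨
      ∣ S ∪ ⁅ t ⁆ ∣                    ≡⟨ cong ∣_∣ (↾-∪⁅⁆ stT t∈T cls-t) ⟨
      ∣ T ↾ Q ∣                        ∎
      where
      open ≡-Reasoning
      stS'x' : Subtransversal (S' ∪ ⁅ x' ⁆)
      stS'x' = ↾above-∪⁅⁆-subtransversal stT' cls-x'
      ω∉A∩Q₀ : ω ∉ A ∩ Q₀
      ω∉A∩Q₀ = x∉above-x ω ∘ p∩q⊆q A Q₀
      count-at-ω : Dec (ω ∈ A) → r (S' ∪ ⁅ x' ⁆) + ∣ A ∩ Q ∣ ≡ suc (r S' + ∣ A ∩ Q₀ ∣)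
      count-at-ω (yes ω∈A) = begin
        r (S' ∪ ⁅ x' ⁆) + ∣ A ∩ Q ∣        ≡⟨ cong₂ _+_ (spans⇒r-∪⁅⁆≡r stS'x' (ω∈A⇒spans-x' ω∈A))
                                                         (cong ∣_∣ (p∩[q∪⁅x⁆]≡p∩q∪⁅x⁆ Q₀ ω∈A)) ⟩
        r S' + ∣ A ∩ Q₀ ∪ ⁅ ω ⁆ ∣          ≡⟨ cong (r S' +_) (∣p∪⁅x⁆∣≡1+∣p∣ (A ∩ Q₀) ω∉A∩Q₀) ⟩
        r S' + suc ∣ A ∩ Q₀ ∣              ≡⟨ +-suc (r S') ∣ A ∩ Q₀ ∣ ⟩
        suc (r S' + ∣ A ∩ Q₀ ∣)            ∎
      count-at-ω (no ω∉A) = cong₂ _+_ (¬spans⇒r-∪⁅⁆≡1+r stS'x' (ω∉A ∘ spans-x'⇒ω∈A))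
                                      (cong ∣_∣ (p∩[q∪⁅x⁆]≡p∩q Q₀ ω∉A))

    module _ {ρ : Subset N} (stρ : Subtransversal ρ) (avoids : Avoids ρ Q) where

      avoids₀ : Avoids ρ Q₀
      avoids₀ z∈ρ cls-z∈Q₀ = avoids z∈ρ (p⊆p∪q ⁅ ω ⁆ cls-z∈Q₀)

      ρ-misses-ω : ∀ {y z} → cls y ≡ ω → z ∈ ρ → cls z ≢ cls y
      ρ-misses-ω cls-y z∈ρ cls-z≡cls-y =
        avoids z∈ρ (q⊆p∪q Q₀ ⁅ ω ⁆ (subst (_∈ ⁅ ω ⁆) (sym (trans cls-z≡cls-y cls-y)) (x∈⁅x⁆ ω)))

      ρ∪⁅⁆-subtransversal : ∀ {y} → cls y ≡ ω → Subtransversal (ρ ∪ ⁅ y ⁆)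
      ρ∪⁅⁆-subtransversal {y} cls-y = ∪-subtransversal stρ (⁅⁆-subtransversal y) λ z∈ρ y'∈⁅y⁆ →
        subst (λ y' → cls _ ≢ cls y') (sym (x∈⁅y⁆⇒x≡y y y'∈⁅y⁆)) (ρ-misses-ω cls-y z∈ρ)

      ρ∪⁅⁆-avoids : ∀ {y} → cls y ≡ ω → Avoids (ρ ∪ ⁅ y ⁆) Q₀
      ρ∪⁅⁆-avoids {y} cls-y z∈ with x∈p∪q⁻ ρ ⁅ y ⁆ z∈
      ... | inj₁ z∈ρ   = avoids₀ z∈ρ
      ... | inj₂ z∈⁅y⁆ = subst (λ z → cls z ∉ Q₀) (sym (x∈⁅y⁆⇒x≡y y z∈⁅y⁆)) (cls≡ω⇒∉Q₀ cls-y)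

      ↾Q∪ρ≡ : ∀ {X x} → Subtransversal X → x ∈ X → cls x ≡ ω → X ↾ Q ∪ ρ ≡ X ↾ Q₀ ∪ (ρ ∪ ⁅ x ⁆)
      ↾Q∪ρ≡ {X} {x} stX x∈X cls-x = begin
        X ↾ Q ∪ ρ             ≡⟨ cong (_∪ ρ) (↾-∪⁅⁆ stX x∈X cls-x) ⟩
        (X ↾ Q₀ ∪ ⁅ x ⁆) ∪ ρ  ≡⟨ ∪-assoc (X ↾ Q₀) ⁅ x ⁆ ρ ⟩
        X ↾ Q₀ ∪ (⁅ x ⁆ ∪ ρ)  ≡⟨ cong (X ↾ Q₀ ∪_) (∪-comm ⁅ x ⁆ ρ) ⟩
        X ↾ Q₀ ∪ (ρ ∪ ⁅ x ⁆)  ∎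
        where open ≡-Reasoning

      ↾Q₀∪ρ∪⁅⁆-subtransversal : ∀ {X y} → Subtransversal X → cls y ≡ ω →
                                Subtransversal ((X ↾ Q₀ ∪ ρ) ∪ ⁅ y ⁆)
      ↾Q₀∪ρ∪⁅⁆-subtransversal {X} {y} stX cls-y =
        subst Subtransversal (sym (∪-assoc (X ↾ Q₀) ρ ⁅ y ⁆))
              (↾-∪-subtransversal stX (ρ∪⁅⁆-subtransversal cls-y) (ρ∪⁅⁆-avoids cls-y))

      rank-shift-same : t ≡ x' → r (T' ↾ Q ∪ ρ) + ∣ (T ─ T') ↾ Q ∣ ≡ r (T ↾ Q ∪ ρ)
      rank-shift-same t≡x' = begin
        r (T' ↾ Q ∪ ρ) + ∣ (T ─ T') ↾ Q ∣
          ≡⟨ cong₂ (λ X Y → r X + ∣ Y ∣) (↾Q∪ρ≡ stT' x'∈T' cls-x') (↾-∪⁅⁆-missing T─T'-misses-ω) ⟩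
        r (S' ∪ (ρ ∪ ⁅ x' ⁆)) + d₀
          ≡⟨ rank-shift (ρ∪⁅⁆-subtransversal cls-x') (ρ∪⁅⁆-avoids cls-x') ⟩
        r (S ∪ (ρ ∪ ⁅ x' ⁆))
          ≡⟨ cong (λ y → r (S ∪ (ρ ∪ ⁅ y ⁆))) t≡x' ⟨
        r (S ∪ (ρ ∪ ⁅ t ⁆))
          ≡⟨ cong r (↾Q∪ρ≡ stT t∈T cls-t) ⟨
        r (T ↾ Q ∪ ρ)
          ∎
        where
        open ≡-Reasoning
        T─T'-misses-ω : ∀ {z} → z ∈ T ─ T' → cls z ≢ ω
        T─T'-misses-ω {z} z∈ cls-z = x∈p─q⇒x∉q z∈ (subst (_∈ T') (sym z≡x') x'∈T')
          where
          z≡x' : z ≡ x'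
          z≡x' = trans (stT (p─q⊆p T T' z∈) t∈T (trans cls-z (sym cls-t))) t≡x'

      S∪ρ-misses-ω : ∀ {z} → z ∈ S ∪ ρ → cls z ≢ cls t
      S∪ρ-misses-ω z∈ with x∈p∪q⁻ S ρ z∈
      ... | inj₁ z∈S = ↾Q₀-misses-ω z∈S cls-t
      ... | inj₂ z∈ρ = ρ-misses-ω cls-t z∈ρ

      S'∪ρ-spans-x' : t ≢ x' → Spans (S' ∪ ρ) x'
      S'∪ρ-spans-x' t≢x' = spans-mono (↾Q₀∪ρ∪⁅⁆-subtransversal stT' cls-x') (p⊆p∪q ρ)
                                      (spans-S⇒spans-S' cls-x' (t≢x'⇒spans-x' t≢x'))

      S∪ρ-¬spans-t : t ≢ x' → ¬ Spans (S ∪ ρ) t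
      S∪ρ-¬spans-t t≢x' spans-t = t≢x' (spans-unique (↾-∪-subtransversal stT stρ avoids₀) S∪ρ-misses-ω
        (trans cls-t (sym cls-x')) spans-t S∪ρ-spans-x')
        where
        S∪ρ-spans-x' : Spans (S ∪ ρ) x'
        S∪ρ-spans-x' = spans-mono (↾Q₀∪ρ∪⁅⁆-subtransversal stT cls-x') (p⊆p∪q ρ) (t≢x'⇒spans-x' t≢x')

      rank-shift-different : t ≢ x' → r (T' ↾ Q ∪ ρ) + ∣ (T ─ T') ↾ Q ∣ ≡ r (T ↾ Q ∪ ρ)
      rank-shift-different t≢x' = begin
        r (T' ↾ Q ∪ ρ) + ∣ (T ─ T') ↾ Q ∣
          ≡⟨ cong₂ (λ X Y → r X + ∣ Y ∣) (↾Q∪ρ≡ stT' x'∈T' cls-x') (↾-∪⁅⁆ stT─T' t∈T─T' cls-t) ⟩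
        r (S' ∪ (ρ ∪ ⁅ x' ⁆)) + ∣ (T ─ T') ↾ Q₀ ∪ ⁅ t ⁆ ∣
          ≡⟨ cong₂ _+_ (cong r (sym (∪-assoc S' ρ ⁅ x' ⁆))) (∣↾∪⁅⁆∣≡1+∣↾∣ (cls≡ω⇒∉Q₀ cls-t)) ⟩
        r ((S' ∪ ρ) ∪ ⁅ x' ⁆) + suc d₀
          ≡⟨ cong (_+ suc d₀) (spans⇒r-∪⁅⁆≡r (↾Q₀∪ρ∪⁅⁆-subtransversal stT' cls-x') (S'∪ρ-spans-x' t≢x')) ⟩
        r (S' ∪ ρ) + suc d₀
          ≡⟨ +-suc (r (S' ∪ ρ)) d₀ ⟩
        suc (r (S' ∪ ρ) + d₀)
          ≡⟨ cong suc (rank-shift stρ avoids₀) ⟩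
        suc (r (S ∪ ρ))
          ≡⟨ ¬spans⇒r-∪⁅⁆≡1+r (↾Q₀∪ρ∪⁅⁆-subtransversal stT cls-t) (S∪ρ-¬spans-t t≢x') ⟨
        r ((S ∪ ρ) ∪ ⁅ t ⁆)
          ≡⟨ cong r (∪-assoc S ρ ⁅ t ⁆) ⟩
        r (S ∪ (ρ ∪ ⁅ t ⁆))
          ≡⟨ cong r (↾Q∪ρ≡ stT t∈T cls-t) ⟨
        r (T ↾ Q ∪ ρ)
          ∎
        where
        open ≡-Reasoning
        t∈T─T' : t ∈ T ─ T'
        t∈T─T' = x∈p∧x∉q⇒x∈p─q t∈T λ t∈T' → t≢x' (stT' t∈T' x'∈T' (trans cls-t (sym cls-x')))
        stT─T' : Subtransversal (T ─ T')
        stT─T' = ⊆-subtransversal stT (p─q⊆p T T')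

      rank-shift-step : Dec (t ≡ x') → r (T' ↾ Q ∪ ρ) + ∣ (T ─ T') ↾ Q ∣ ≡ r (T ↾ Q ∪ ρ)
      rank-shift-step (yes t≡x') = rank-shift-same t≡x'
      rank-shift-step (no  t≢x') = rank-shift-different t≢x'

    invariant : Invariant Q
    invariant = record
      { rank-shift = λ stρ avoids → rank-shift-step stρ avoids (t ≟ x')
      ; rank-count = rank-count-step
      }

  invariant-⊤ : Invariant ⊤
  invariant-⊤ = upset-induction Invariant invariant-⊥ Step.invariant

  nullity-formula : nullity Z T + ∣ T ─ T' ∣ ≡ ∣ A ∣
  nullity-formula = begin
    ∣ T ∣ ∸ r T + ∣ T ─ T' ∣
      ≡⟨ cong₂ (λ n s → n ∸ s + ∣ T ─ T' ∣) (sym count) (sym shift) ⟩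
    (r T' + ∣ A ∣) ∸ (r T' + ∣ T ─ T' ∣) + ∣ T ─ T' ∣
      ≡⟨ [m+n]∸[m+o]+o≡n (r T') shift≤count ⟩
    ∣ A ∣
      ∎
    where
    open ≡-Reasoning
    shift : r T' + ∣ T ─ T' ∣ ≡ r T
    shift = subst₂ (λ X Y → r X + ∣ Y ∣ ≡ r T) (↾-⊤ T') (↾-⊤ (T ─ T'))
              (subst (λ X → r (T' ↾ ⊤) + ∣ (T ─ T') ↾ ⊤ ∣ ≡ r X) (↾-⊤ T) (rank-shift₀ invariant-⊤))
    count : r T' + ∣ A ∣ ≡ ∣ T ∣
    count = subst₂ (λ X Y → r X + ∣ Y ∣ ≡ ∣ T ∣) (↾-⊤ T') (∩-identityʳ A)
              (subst (λ X → r (T' ↾ ⊤) + ∣ A ∩ ⊤ ∣ ≡ ∣ X ∣) (↾-⊤ T) (Invariant.rank-count invariant-⊤))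
    shift≤count : r T' + ∣ T ─ T' ∣ ≤ r T' + ∣ A ∣
    shift≤count = subst₂ _≤_ (sym shift) (sym count) (r-bound stT)

open Multimatroid using (N; m; cls)

proposition4p10 : (Z : Multimatroid)
    → (_≺_ : Fin (m Z) → Fin (m Z) → Set) → IsStrictTotalOrder _≡_ _≺_
    → (T : Subset (N Z)) → IsTransversal (cls Z) T
    → (T' : Subset (N Z)) → IsCcl Z _≺_ T T'
    → (A : Subset (m Z)) → IsActSet Z _≺_ T' A
    → nullity Z T + ∣ T ─ T' ∣ ≡ ∣ A ∣
proposition4p10 Z _≺_ ≺-isStrictTotalOrder T T-transversal T' T'-ccl A A-active =
  NullityFormula.nullity-formula Z ≺-isStrictTotalOrder T-transversal T'-ccl A-active
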